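{- Let $2\leq k\in\mathbb{N}$, let $\mathbf{X},\mathbf{A}$ be digraphs, and suppose that $\mathrm{BA}^{2k}(\mathbf{X},\mathbf{A})=\textsc{Yes}$ and $E(\delta\mathbf{A})\neq\emptyset$. Then $\mathrm{BA}^{k}(\delta\mathbf{X},\delta\mathbf{A})=\textsc{Yes}$.
   Context: Digraphs are finite, with vertex set $V(\cdot)$ and edge set $E(\cdot)\subseteq V(\cdot)^2$. The line digraph $\delta\mathbf{X}$ of $\mathbf{X}$ has vertex set $E(\mathbf{X})$ and edge set $\{((x,y),(y,z)):(x,y),(y,z)\in E(\mathbf{X})\}$. For a tuple $\mathbf{z}=(z_1,\dots,z_m)$ and $\mathbf{i}\in[m]^p$, $\mathbf{z}_{\mathbf{i}}=(z_{i_1},\dots,z_{i_p})$. For tuples of equal length, $\mathbf{s}\prec\mathbf{t}$ means $s_i=s_j\Rightarrow t_i=t_j$ for all $i,j$; $\not\prec$ is its negation. For digraphs $\mathbf{X},\mathbf{A}$ and $k\geq2$, take variables $\lambda_{\mathbf{x},\mathbf{a}}$ ($\mathbf{x}\in V(\mathbf{X})^k,\mathbf{a}\in V(\mathbf{A})^k$), $\mu_{\mathbf{y},\mathbf{b}}$ ($\mathbf{y}\in E(\mathbf{X}),\mathbf{b}\in E(\mathbf{A})$) and equations: (1) $\sum_{\mathbf{a}}\lambda_{\mathbf{x},\mathbf{a}}=1$; (2) $\sum_{\hat{\mathbf{a}}:\hat{\mathbf{a}}_{\mathbf{i}}=\mathbf{a}}\lambda_{\mathbf{x},\hat{\mathbf{a}}}=\lambda_{\mathbf{x}_{\mathbf{i}},\mathbf{a}}$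 for all $\mathbf{x},\mathbf{a}$, $\mathbf{i}\in[k]^k$; (3) $\sum_{\mathbf{b}\in E(\mathbf{A}):\mathbf{b}_{\mathbf{i}}=\mathbf{a}}\mu_{\mathbf{y},\mathbf{b}}=\lambda_{\mathbf{y}_{\mathbf{i}},\mathbf{a}}$ for all $\mathbf{y}\in E(\mathbf{X}),\mathbf{a}$, $\mathbf{i}\in[2]^k$; (4) $\lambda_{\mathbf{x},\mathbf{a}}=0$ if $\mathbf{x}\not\prec\mathbf{a}$; (5) $\mu_{\mathbf{y},\mathbf{b}}=0$ if $\mathbf{y}\not\prec\mathbf{b}$. $\mathrm{BA}^k(\mathbf{X},\mathbf{A})=\textsc{Yes}$ means the system has a nonnegative rational solution and an integer solution such that every variable equal to $0$ in the rational solution is $0$ in the integer solution. -}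

module Defs where

open import Data.Bool using (Bool; T)
open import Data.Bool.Properties using (T-irrelevant)
open import Data.Nat using (ℕ; zero; suc)
open import Data.Fin using (Fin)
open import Data.Product using (Σ; _×_; _,_; proj₁; proj₂; Σ-syntax)
open import Data.Product.Properties using (≡-dec)
open import Data.List using (List; []; _∷_; foldr; filter; map; concatMap; cartesianProduct)
open import Data.List.Membership.Propositional using (_∈_; _∉_)
open import Data.List.Membership.Propositional.Properties using (∈-cartesianProduct⁺)
open import Data.List.Relation.Unary.Any using (here; there)
open import Data.List.Relation.Unary.All as All using (All; []; _∷_)
open import Data.List.Relation.Unary.Unique.Propositional using (Unique)
open import Data.List.Relation.Unary.Unique.Propositional.Properties using (cartesianProduct⁺)
open import Data.List.Relation.Unary.AllPairs using ([]; _∷_)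
open import Data.Vec as Vec using (Vec; lookup; []; _∷_)
import Data.Vec.Properties as VecP
open import Data.Rational as ℚ using (ℚ; 0ℚ; 1ℚ)
open import Data.Integer as ℤ using (ℤ; 0ℤ; 1ℤ)
open import Relation.Nullary using (¬_; Dec; yes; no; ⌊_⌋)
open import Relation.Nullary.Decidable using (T?)
open import Relation.Binary.Definitions using (DecidableEquality)
open import Relation.Binary.PropositionalEquality using (_≡_; refl; cong; sym; subst)

record Digraph : Set₁ where
  field
    V        : Set
    _≟_      : DecidableEquality V
    vertices : List V
    unique   : Unique vertices
    complete : ∀ v → v ∈ vertices
    E        : V → V → Bool

Edge : Digraph → Set
Edge G = Σ (V × V) (λ p → T (E (proj₁ p) (proj₂ p)))
  where open Digraph G

module _ (G : Digraph) where
  open Digraph G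

  edgesFrom : List (V × V) → List (Edge G)
  edgesFrom [] = []
  edgesFrom (p ∷ ps) with T? (E (proj₁ p) (proj₂ p))
  ... | yes t = (p , t) ∷ edgesFrom ps
  ... | no _  = edgesFrom ps

  edges : List (Edge G)
  edges = edgesFrom (cartesianProduct vertices vertices)

  _≟E_ : DecidableEquality (Edge G)
  ((a , b) , s) ≟E ((c , d) , t) with ≡-dec _≟_ _≟_ (a , b) (c , d)
  ... | no ne = no (λ eq → ne (cong proj₁ eq))
  ... | yes refl with T-irrelevant s t
  ... | refl = yes refl

  private
    edgesFrom⁻ : ∀ {e} ps → e ∈ edgesFrom ps → proj₁ e ∈ ps
    edgesFrom⁻ (p ∷ ps) m with T? (E (proj₁ p) (proj₂ p))
    edgesFrom⁻ (p ∷ ps) (here refl) | yes t = here refl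
    edgesFrom⁻ (p ∷ ps) (there m)   | yes t = there (edgesFrom⁻ ps m)
    ... | no _ = there (edgesFrom⁻ ps m)

    edgesFrom⁺ : ∀ {e} ps → proj₁ e ∈ ps → e ∈ edgesFrom ps
    edgesFrom⁺ {(p , s)} (q ∷ ps) m with T? (E (proj₁ q) (proj₂ q))
    edgesFrom⁺ {(p , s)} (q ∷ ps) (here refl) | yes t with T-irrelevant s t
    ... | refl = here refl
    edgesFrom⁺ {(p , s)} (q ∷ ps) (there m) | yes t = there (edgesFrom⁺ ps m)
    edgesFrom⁺ {(p , s)} (q ∷ ps) (here refl) | no ¬t = Relation.Nullary.contradiction s ¬t
      where import Relation.Nullary
    edgesFrom⁺ {(p , s)} (q ∷ ps) (there m) | no _ = edgesFrom⁺ ps m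

    edgesFrom-unique : ∀ ps → Unique ps → Unique (edgesFrom ps)
    edgesFrom-unique [] _ = []
    edgesFrom-unique (p ∷ ps) (px ∷ u) with T? (E (proj₁ p) (proj₂ p))
    ... | yes t = All.tabulate (λ {e'} m eq → All.lookup px (edgesFrom⁻ ps m) (cong proj₁ eq))
                  ∷ edgesFrom-unique ps u
    ... | no _ = edgesFrom-unique ps u

  edges-unique : Unique edges
  edges-unique = edgesFrom-unique _ (cartesianProduct⁺ unique unique)

  edges-complete : ∀ e → e ∈ edges
  edges-complete ((a , b) , t) = edgesFrom⁺ _ (∈-cartesianProduct⁺ (complete a) (complete b))

δ : Digraph → Digraph
δ G = record
  { V        = Edge G
  ; _≟_      = _≟E_ G
  ; vertices = edges G
  ; unique   = edges-unique G
  ; complete = edges-complete G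
  ; E        = λ e f → ⌊ proj₂ (proj₁ e) ≟ proj₁ (proj₁ f) ⌋
  }
  where open Digraph G

tuples : ∀ {A : Set} → List A → (k : ℕ) → List (Vec A k)
tuples xs zero    = [] ∷ []
tuples xs (suc k) = concatMap (λ x → map (x ∷_) (tuples xs k)) xs

select : ∀ {A : Set} {m p} → Vec A m → Vec (Fin m) p → Vec A p
select z i = Vec.map (lookup z) i

_≺_ : ∀ {A B : Set} {m} → Vec A m → Vec B m → Set
s ≺ t = ∀ i j → lookup s i ≡ lookup s j → lookup t i ≡ lookup t j

pair : ∀ {G : Digraph} → Edge G → Vec (Digraph.V G) 2
pair ((a , b) , _) = a ∷ b ∷ []

sumOver : ∀ {A R : Set} → R → (R → R → R) → List A → (A → R) → R
sumOver 0r _+_ xs f = foldr (λ x r → f x + r) 0r xs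

record Solves (R : Set) (0r 1r : R) (_+_ : R → R → R)
              (k : ℕ) (X A : Digraph)
              (lam : Vec (Digraph.V X) k → Vec (Digraph.V A) k → R)
              (mu  : Edge X → Edge A → R) : Set where
  private
    module X = Digraph X
    module A = Digraph A
    Σ' : ∀ {I : Set} → List I → (I → R) → R
    Σ' = sumOver 0r _+_
    _≟ᵏ_ : DecidableEquality (Vec A.V k)
    _≟ᵏ_ = VecP.≡-dec A._≟_
  field
    eq1 : ∀ (x : Vec X.V k) → Σ' (tuples A.vertices k) (lam x) ≡ 1r
    eq2 : ∀ (x : Vec X.V k) (a : Vec A.V k) (i : Vec (Fin k) k) →
          Σ' (filter (λ â → select â i ≟ᵏ a) (tuples A.vertices k)) (lam x)
            ≡ lam (select x i) a
    eq3 : ∀ (y : Edge X) (a : Vec A.V k) (i : Vec (Fin 2) k) →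
          Σ' (filter (λ b → select (pair {A} b) i ≟ᵏ a) (edges A)) (mu y)
            ≡ lam (select (pair {X} y) i) a
    eq4 : ∀ (x : Vec X.V k) (a : Vec A.V k) → ¬ (x ≺ a) → lam x a ≡ 0r
    eq5 : ∀ (y : Edge X) (b : Edge A) → ¬ (pair {X} y ≺ pair {A} b) → mu y b ≡ 0r

BA : ℕ → Digraph → Digraph → Set
BA k X A =
  Σ[ lq ∈ (Vec (Digraph.V X) k → Vec (Digraph.V A) k → ℚ) ]
  Σ[ mq ∈ (Edge X → Edge A → ℚ) ]
  Σ[ lz ∈ (Vec (Digraph.V X) k → Vec (Digraph.V A) k → ℤ) ]
  Σ[ mz ∈ (Edge X → Edge A → ℤ) ]
    ( (∀ x a → 0ℚ ℚ.≤ lq x a) × (∀ y b → 0ℚ ℚ.≤ mq y b)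
    × Solves ℚ 0ℚ 1ℚ ℚ._+_ k X A lq mq
    × Solves ℤ 0ℤ 1ℤ ℤ._+_ k X A lz mz
    × (∀ x a → lq x a ≡ 0ℚ → lz x a ≡ 0ℤ)
    × (∀ y b → mq y b ≡ 0ℚ → mz y b ≡ 0ℤ) )

-- A k-tuple x of edges of X is flattened to the 2k-tuple of its endpoints, and an edge (e, f) of δX
-- is padded to the k-tuple (e, f, f, …, f). From a solution (λ, μ) of BA^{2k}(X, A) one takes
-- λ'(x, a) = λ(flat x, flat a) and μ'(y, b) = λ'(pad y, pad b), over ℚ and over ℤ alike.
-- The key fact is that λ(x̂, ĉ) = 0 as soon as ĉ sends an edge between two coordinates of x̂ to a
-- non-edge: over ℚ, equation (3) for that edge has no term left, so every term of the matching
-- instance of (2) vanishes by nonnegativity; over ℤ this follows from the support condition.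
-- So the sums over V(A)^{2k} in the equations for λ are sums over flattened tuples, giving (1) and
-- (2) for λ'. Equation (3) for μ' is (2) for λ' at pad y, since by (4) λ(flat (pad y), flat c) = 0
-- unless c is itself a padded edge of δA; (4) and (5) hold because flattening and padding reflect ≺.

module Submission where

open import Defs
open import Algebra.Structures using (IsCommutativeMonoid)
open import Data.Bool using (true; false; T; if_then_else_)
open import Data.Bool.Properties using (T-irrelevant)
open import Data.Empty using (⊥-elim)
open import Data.Fin using (Fin; zero; suc; combine; remQuot; _↑ˡ_)
open import Data.Fin.Properties using (remQuot-combine; combine-remQuot; all?; ¬∀⟶∃¬)
open import Data.Integer using (0ℤ)
import Data.Integer.Properties as ℤP
open import Data.List using (List; []; _∷_; map; filter; foldr; concatMap; _++_; cartesianProductWith)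
open import Data.List.Properties using (foldr-map; filter-none)
open import Data.List.Membership.Propositional using (_∈_; _∉_)
open import Data.List.Membership.Propositional.Properties
  using (∈-map⁺; ∈-filter⁺; ∈-filter⁻; ∈-cartesianProductWith⁺)
open import Data.List.Membership.Propositional.Properties.WithK using (unique∧set⇒bag)
import Data.List.Membership.DecPropositional as DecMembership
open import Data.List.Relation.Binary.BagAndSetEquality using (∼bag⇒↭)
open import Data.List.Relation.Binary.Permutation.Propositional using (_↭_; ↭⇒↭ₛ)
import Data.List.Relation.Binary.Permutation.Propositional.Properties as ↭
import Data.List.Relation.Binary.Permutation.Setoid.Properties as ↭ₛ
open import Data.List.Relation.Unary.All as All using (All)
import Data.List.Relation.Unary.AllPairs as AllPairs
open import Data.List.Relation.Unary.Any using (here; there)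
open import Data.List.Relation.Unary.Unique.Propositional using (Unique)
import Data.List.Relation.Unary.Unique.Propositional.Properties as Unique
open import Data.Nat using (ℕ; suc; _+_; _≤_; _*_; s≤s; z≤n)
open import Data.Product using (Σ-syntax; _,_; proj₁; proj₂)
open import Data.Rational as ℚ using (ℚ; 0ℚ; 1ℚ)
import Data.Rational.Properties as ℚP
open import Data.Sum using (_⊎_; inj₁; inj₂)
open import Data.Vec as Vec using (Vec; _∷_; lookup; tabulate; replicate)
import Data.Vec.Properties as Vec
open import Data.Vec.Relation.Binary.Pointwise.Extensional using (ext; Pointwise-≡⇒≡)
open import Function using (_∘_; _⇔_; mk⇔)
open import Function.Definitions using (Injective)
open import Relation.Binary.Definitions using (DecidableEquality)
open import Relation.Binary.PropositionalEquality
  using (_≡_; refl; cong; cong₂; sym; trans; subst; subst₂; setoid; module ≡-Reasoning)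
open import Relation.Nullary using (¬_; Dec; yes; no; does)
open import Relation.Nullary.Decidable using (T?; toWitness; fromWitness; does-⇔)
open import Relation.Unary using (Pred; Decidable)

open Digraph using (V; E)

module ListSum {R : Set} {0r : R} {_+_ : R → R → R}
               (+-isCommutativeMonoid : IsCommutativeMonoid _≡_ _+_ 0r) where
  open IsCommutativeMonoid +-isCommutativeMonoid using (identityˡ)

  sum : ∀ {I : Set} → List I → (I → R) → R
  sum = sumOver 0r _+_

  module _ {I : Set} where

    sum-cong : ∀ (L : List I) {f g : I → R} → (∀ x → f x ≡ g x) → sum L f ≡ sum L g
    sum-cong []      f≗g = refl
    sum-cong (x ∷ L) f≗g = cong₂ _+_ (f≗g x) (sum-cong L f≗g)

    sum-map : ∀ {J : Set} (φ : I → J) (L : List I) (f : J → R) → sum (map φ L) f ≡ sum L (f ∘ φ)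
    sum-map φ L f = foldr-map (λ y r → f y + r) φ 0r L

    sum-↭ : ∀ {L M : List I} (f : I → R) → L ↭ M → sum L f ≡ sum M f
    sum-↭ {L} {M} f L↭M = begin
      sum L f                 ≡⟨ foldr-map _+_ f 0r L ⟨
      foldr _+_ 0r (map f L)  ≡⟨ ↭ₛ.foldr-commMonoid (setoid R) +-isCommutativeMonoid
                                   (↭⇒↭ₛ (↭.map⁺ f L↭M)) ⟩
      foldr _+_ 0r (map f M)  ≡⟨ foldr-map _+_ f 0r M ⟩
      sum M f                 ∎
      where open ≡-Reasoning

    module _ {p} {P : Pred I p} (P? : Decidable P) where

      sum-filter : ∀ (L : List I) (f : I → R) →
                   sum (filter P? L) f ≡ sum L (λ x → if does (P? x) then f x else 0r)
      sum-filter []      f = refl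
      sum-filter (x ∷ L) f with does (P? x)
      ... | true  = cong (f x +_) (sum-filter L f)
      ... | false = trans (sum-filter L f) (sym (identityˡ _))

      sum-filter-supported : ∀ (L : List I) {f : I → R} → (∀ x → ¬ P x → f x ≡ 0r) →
                             sum (filter P? L) f ≡ sum L f
      sum-filter-supported L {f} f0 = trans (sum-filter L f) (sum-cong L unmask)
        where
        unmask : ∀ x → (if does (P? x) then f x else 0r) ≡ f x
        unmask x with P? x
        ... | yes _  = refl
        ... | no ¬Px = sym (f0 x ¬Px)

    sum-supported : DecidableEquality I → ∀ {L M : List I} {f : I → R} →
                    Unique L → Unique M → (∀ x → x ∈ M) → (∀ x → x ∉ L → f x ≡ 0r) →
                    sum L f ≡ sum M f
    sum-supported _≟_ {L} {M} {f} uL uM complete f0 = begin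
      sum L f                   ≡⟨ sum-↭ f L↭M∩L ⟩
      sum (filter (_∈? L) M) f  ≡⟨ sum-filter-supported (_∈? L) M f0 ⟩
      sum M f                   ∎
      where
      open ≡-Reasoning
      open DecMembership _≟_ using (_∈?_)
      L↭M∩L : L ↭ filter (_∈? L) M
      L↭M∩L = ∼bag⇒↭ (unique∧set⇒bag uL (Unique.filter⁺ (_∈? L) uM)
                (mk⇔ (∈-filter⁺ (_∈? L) (complete _)) (proj₂ ∘ ∈-filter⁻ (_∈? L) {xs = M})))

  if-zero : ∀ {P : Set} (P? : Dec P) {r : R} → (P → r ≡ 0r) → (if does P? then r else 0r) ≡ 0r
  if-zero (yes p) r≡0 = r≡0 p
  if-zero (no _)  _   = refl

  sum-injective-image : ∀ {I J : Set} → DecidableEquality J →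
                        ∀ {φ : I → J} {L : List I} {M : List J} {g : J → R} →
                        Injective _≡_ _≡_ φ → Unique L → Unique M → (∀ y → y ∈ M) →
                        (∀ y → y ∉ map φ L → g y ≡ 0r) →
                        sum L (g ∘ φ) ≡ sum M g
  sum-injective-image _≟_ {φ} {L} φ-inj uL uM complete g0 =
    trans (sym (sum-map φ L _)) (sum-supported _≟_ (Unique.map⁺ φ-inj uL) uM complete g0)

module _ where
  open ListSum ℚP.+-0-isCommutativeMonoid using (sum)

  sum-nonneg : ∀ {I : Set} (L : List I) {f : I → ℚ} → (∀ x → 0ℚ ℚ.≤ f x) → 0ℚ ℚ.≤ sum L f
  sum-nonneg []      f≥0 = ℚP.≤-refl
  sum-nonneg (x ∷ L) f≥0 = ℚP.+-mono-≤ (f≥0 x) (sum-nonneg L f≥0)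

  ∈⇒≤-sum : ∀ {I : Set} {L : List I} {f : I → ℚ} → (∀ x → 0ℚ ℚ.≤ f x) →
            ∀ {x} → x ∈ L → f x ℚ.≤ sum L f
  ∈⇒≤-sum {L = y ∷ L} {f} f≥0 (here refl) =
    subst (ℚ._≤ f y ℚ.+ sum L f) (ℚP.+-identityʳ (f y)) (ℚP.+-monoʳ-≤ (f y) (sum-nonneg L f≥0))
  ∈⇒≤-sum {L = y ∷ L} {f} f≥0 (there x∈L) =
    ℚP.≤-trans (∈⇒≤-sum f≥0 x∈L)
      (subst (ℚ._≤ f y ℚ.+ sum L f) (ℚP.+-identityˡ (sum L f)) (ℚP.+-monoˡ-≤ (sum L f) (f≥0 y)))

  sum≡0⇒∈⇒≡0 : ∀ {I : Set} {L : List I} {f : I → ℚ} → (∀ x → 0ℚ ℚ.≤ f x) →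
               sum L f ≡ 0ℚ → ∀ {x} → x ∈ L → f x ≡ 0ℚ
  sum≡0⇒∈⇒≡0 f≥0 sum≡0 x∈L = ℚP.≤-antisym (subst (_ ℚ.≤_) sum≡0 (∈⇒≤-sum f≥0 x∈L)) (f≥0 _)

module _ {A : Set} where

  concatMap-map≡cartesianProductWith : ∀ {B C : Set} (f : A → B → C) (xs : List A) (ys : List B) →
    concatMap (λ x → map (f x) ys) xs ≡ cartesianProductWith f xs ys
  concatMap-map≡cartesianProductWith f []       ys = refl
  concatMap-map≡cartesianProductWith f (x ∷ xs) ys =
    cong (map (f x) ys ++_) (concatMap-map≡cartesianProductWith f xs ys)

  tuples-suc : ∀ (xs : List A) k → tuples xs (suc k) ≡ cartesianProductWith _∷_ xs (tuples xs k)
  tuples-suc xs k = concatMap-map≡cartesianProductWith _∷_ xs (tuples xs k)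

  tuples-complete : ∀ {xs : List A} → (∀ x → x ∈ xs) → ∀ k (v : Vec A k) → v ∈ tuples xs k
  tuples-complete complete _       Vec.[]  = here refl
  tuples-complete {xs} complete (suc k) (x ∷ v) rewrite tuples-suc xs k =
    ∈-cartesianProductWith⁺ _∷_ (complete x) (tuples-complete complete k v)

  tuples-unique : ∀ {xs : List A} → Unique xs → ∀ k → Unique (tuples xs k)
  tuples-unique uxs 0       = All.[] AllPairs.∷ AllPairs.[]
  tuples-unique {xs} uxs (suc k) rewrite tuples-suc xs k =
    Unique.cartesianProductWith⁺ _∷_ Vec.∷-injective uxs (tuples-unique uxs k)

module _ {A B : Set} where

  spread : ∀ {k} → (Fin 2 → A → B) → Vec A k → Vec B (2 * k)
  spread {k} f x = tabulate λ t → f (proj₁ (remQuot {2} k t)) (lookup x (proj₂ (remQuot {2} k t)))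

  lookup-spread : ∀ {k} (f : Fin 2 → A → B) (x : Vec A k) (r : Fin 2) (j : Fin k) →
                  lookup (spread f x) (combine r j) ≡ f r (lookup x j)
  lookup-spread f x r j = trans (Vec.lookup∘tabulate _ (combine r j))
                                (cong (λ (r , j) → f r (lookup x j)) (remQuot-combine r j))

spread-ext : ∀ {B : Set} {k} {u v : Vec B (2 * k)} →
             (∀ (r : Fin 2) (j : Fin k) → lookup u (combine r j) ≡ lookup v (combine r j)) → u ≡ v
spread-ext {k = k} {u} {v} u≗v = Pointwise-≡⇒≡ (ext λ t →
  subst (λ t → lookup u t ≡ lookup v t) (combine-remQuot {2} k t)
        (u≗v (proj₁ (remQuot {2} k t)) (proj₂ (remQuot {2} k t))))

select-spread : ∀ {A B : Set} {k m} (f : Fin 2 → A → B) (x : Vec A k) (i : Vec (Fin k) m) →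
                select (spread f x) (spread combine i) ≡ spread f (select x i)
select-spread f x i = spread-ext λ r j → begin
  lookup (select (spread f x) (spread combine i)) (combine r j)
    ≡⟨ Vec.lookup-map _ _ (spread combine i) ⟩
  lookup (spread f x) (lookup (spread combine i) (combine r j))
    ≡⟨ cong (lookup (spread f x)) (lookup-spread combine i r j) ⟩
  lookup (spread f x) (combine r (lookup i j))
    ≡⟨ lookup-spread f x r (lookup i j) ⟩
  f r (lookup x (lookup i j))
    ≡⟨ cong (f r) (Vec.lookup-map j (lookup x) i) ⟨
  f r (lookup (select x i) j)
    ≡⟨ lookup-spread f (select x i) r j ⟨
  lookup (spread f (select x i)) (combine r j)
    ∎
  where open ≡-Reasoning

select-++ˡ : ∀ {A : Set} {m n p} (xs : Vec A m) (ys : Vec A n) (i : Vec (Fin m) p) →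
             select (xs Vec.++ ys) (Vec.map (_↑ˡ n) i) ≡ select xs i
select-++ˡ xs ys i = trans (sym (Vec.map-∘ _ _ i)) (Vec.map-cong (Vec.lookup-++ˡ xs ys) i)

select-select : ∀ {A : Set} {m n p} (z : Vec A m) (v : Vec (Fin m) n) (i : Vec (Fin n) p) →
                select z (select v i) ≡ select (select z v) i
select-select z v i = trans (sym (Vec.map-∘ _ _ i)) (Vec.map-cong (λ t → sym (Vec.lookup-map t (lookup z) v)) i)

select-≺ : ∀ {A B : Set} {m n} {s : Vec A m} {t : Vec B m} (i : Vec (Fin m) n) →
           s ≺ t → select s i ≺ select t i
select-≺ {s = s} {t} i s≺t r r′ sr≡sr′ =
  trans (Vec.lookup-map r (lookup t) i)
    (trans (s≺t _ _ (trans (sym (Vec.lookup-map r (lookup s) i)) (trans sr≡sr′ (Vec.lookup-map r′ (lookup s) i))))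
           (sym (Vec.lookup-map r′ (lookup t) i)))

pair-injective : ∀ {G : Digraph} {e f : Edge G} → pair {G} e ≡ pair {G} f → e ≡ f
pair-injective {e = p , s} {q , t} e≡f with Vec.∷-injectiveˡ e≡f | Vec.∷-injectiveˡ (Vec.∷-injectiveʳ e≡f)
... | refl | refl = cong (p ,_) (T-irrelevant s t)

module _ {G : Digraph} where

  endpoint : Fin 2 → Edge G → V G
  endpoint r e = lookup (pair {G} e) r

  endpoints-injective : ∀ {e f : Edge G} → (∀ r → endpoint r e ≡ endpoint r f) → e ≡ f
  endpoints-injective e≗f = pair-injective {G} (cong₂ (λ u v → u ∷ v ∷ Vec.[]) (e≗f zero) (e≗f (suc zero)))

  flatten : ∀ {k} → Vec (Edge G) k → Vec (V G) (2 * k)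
  flatten = spread endpoint

  lookup-flatten : ∀ {k} (x : Vec (Edge G) k) r j → lookup (flatten x) (combine r j) ≡ endpoint r (lookup x j)
  lookup-flatten = lookup-spread endpoint

  flatten-injective : ∀ {k} → Injective _≡_ _≡_ (flatten {k})
  flatten-injective {x = x} {y} x≡y = Pointwise-≡⇒≡ (ext λ j → endpoints-injective λ r →
    trans (sym (lookup-flatten x r j)) (trans (cong (λ z → lookup z (combine r j)) x≡y) (lookup-flatten y r j)))

  EdgeAt : ∀ {k} → Vec (V G) (2 * k) → Fin k → Set
  EdgeAt ĉ j = T (E G (lookup ĉ (combine {2} zero j)) (lookup ĉ (combine {2} (suc zero) j)))

  edgeAt-flatten : ∀ {k} (x : Vec (Edge G) k) j → EdgeAt (flatten x) j
  edgeAt-flatten x j = subst₂ (λ u v → T (E G u v))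
    (sym (lookup-flatten x zero j)) (sym (lookup-flatten x (suc zero) j)) (proj₂ (lookup x j))

  flatten-or-nonEdge : ∀ {k} (ĉ : Vec (V G) (2 * k)) →
    (Σ[ c ∈ Vec (Edge G) k ] flatten c ≡ ĉ) ⊎ (Σ[ j ∈ Fin k ] ¬ EdgeAt ĉ j)
  flatten-or-nonEdge {k} ĉ with all? (λ j → T? (E G _ _))
  ... | yes isEdge = inj₁ (c , spread-ext λ r j → trans (lookup-flatten c r j) (endpoint-c r j))
    where
    edgeAt : Fin k → Edge G
    edgeAt j = (lookup ĉ (combine {2} zero j) , lookup ĉ (combine {2} (suc zero) j)) , isEdge j
    c : Vec (Edge G) k
    c = tabulate edgeAt
    endpoint-c : ∀ r j → endpoint r (lookup c j) ≡ lookup ĉ (combine r j)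
    endpoint-c zero       j = cong (endpoint zero) (Vec.lookup∘tabulate edgeAt j)
    endpoint-c (suc zero) j = cong (endpoint (suc zero)) (Vec.lookup∘tabulate edgeAt j)
  ... | no ¬allEdges = inj₂ (¬∀⟶∃¬ k (EdgeAt ĉ) (λ j → T? _) ¬allEdges)

  pad : ∀ {k'} → Edge (δ G) → Vec (Edge G) (2 + k')
  pad {k'} y = pair {δ G} y Vec.++ replicate k' (proj₂ (proj₁ y))

  select-pad : ∀ {k' m} (y : Edge (δ G)) (i : Vec (Fin 2) m) →
               select (pad {k'} y) (Vec.map (_↑ˡ k') i) ≡ select (pair {δ G} y) i
  select-pad y i = select-++ˡ (pair {δ G} y) _ i

  pad-injective : ∀ {k'} → Injective _≡_ _≡_ (pad {k'})
  pad-injective pad≡pad = pair-injective {δ G}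
    (cong₂ (λ e f → e ∷ f ∷ Vec.[]) (Vec.∷-injectiveˡ pad≡pad) (Vec.∷-injectiveˡ (Vec.∷-injectiveʳ pad≡pad)))

flatten-≺⁻ : ∀ {G H : Digraph} {k} (x : Vec (Edge G) k) (a : Vec (Edge H) k) →
             flatten {G} x ≺ flatten {H} a → x ≺ a
flatten-≺⁻ {G} {H} x a x≺a i j xi≡xj = endpoints-injective {H} λ r →
  trans (sym (lookup-flatten {H} a r i))
    (trans (x≺a (combine r i) (combine r j)
             (trans (lookup-flatten {G} x r i) (trans (cong (endpoint {G} r) xi≡xj) (sym (lookup-flatten {G} x r j)))))
           (lookup-flatten {H} a r j))

pad-≺⁻ : ∀ {G H : Digraph} {k'} (y : Edge (δ G)) (b : Edge (δ H)) →
         pad {G} {k'} y ≺ pad {H} b → pair {δ G} y ≺ pair {δ H} b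
pad-≺⁻ {G} {H} {k'} y b pady≺padb =
  subst₂ _≺_ (select-pad {G} {k'} y ι) (select-pad {H} {k'} b ι)
    (select-≺ {s = pad {G} y} {pad {H} b} (Vec.map (_↑ˡ k') ι) pady≺padb)
  where
  ι : Vec (Fin 2) 2
  ι = zero ∷ suc zero ∷ Vec.[]

padded : ∀ {G H : Digraph} {k'} (y : Edge (δ G)) (c : Vec (Edge H) (2 + k')) →
         flatten {G} (pad {G} {k'} y) ≺ flatten {H} c → Σ[ b ∈ Edge (δ H) ] pad {H} b ≡ c
padded {G} {H} {k'} y c@(c₀ ∷ c₁ ∷ cs) pady≺c =
  ((c₀ , c₁) , fromWitness c-linked) , cong (λ v → c₀ ∷ c₁ ∷ v) (sym cs-constant)
  where
  at : Fin 2 → Fin (2 + k') → Fin (2 * (2 + k'))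
  at = combine
  y-linked : lookup (flatten {G} (pad {G} {k'} y)) (at (suc zero) zero)
           ≡ lookup (flatten {G} (pad {G} {k'} y)) (at zero (suc zero))
  y-linked = trans (lookup-flatten {G} (pad {G} {k'} y) (suc zero) zero)
               (trans (toWitness (proj₂ y)) (sym (lookup-flatten {G} (pad {G} {k'} y) zero (suc zero))))
  c-linked : proj₂ (proj₁ c₀) ≡ proj₁ (proj₁ c₁)
  c-linked = trans (sym (lookup-flatten {H} c (suc zero) zero))
               (trans (pady≺c (at (suc zero) zero) (at zero (suc zero)) y-linked) (lookup-flatten {H} c zero (suc zero)))
  cs-constant : cs ≡ replicate k' c₁
  cs-constant = Pointwise-≡⇒≡ (ext λ j →
    trans (flatten-≺⁻ {G} {H} (pad {G} {k'} y) c pady≺c (suc (suc j)) (suc zero) (Vec.lookup-replicate j _))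
          (sym (Vec.lookup-replicate j c₁)))

EdgeSupported : ∀ {R : Set} → R → ∀ {n} (X A : Digraph) → (Vec (V X) n → Vec (V A) n → R) → Set
EdgeSupported 0r X A l =
  ∀ x̂ ĉ p q → T (E X (lookup x̂ p) (lookup x̂ q)) → ¬ T (E A (lookup ĉ p) (lookup ĉ q)) → l x̂ ĉ ≡ 0r

module _ {n'} {X A : Digraph}
         {l : Vec (V X) (2 + n') → Vec (V A) (2 + n') → ℚ} {m : Edge X → Edge A → ℚ}
         (sol : Solves ℚ 0ℚ 1ℚ ℚ._+_ (2 + n') X A l m) (l≥0 : ∀ x̂ ĉ → 0ℚ ℚ.≤ l x̂ ĉ) where
  open Solves sol
  open ListSum ℚP.+-0-isCommutativeMonoid using (sum)

  edge-support : EdgeSupported 0ℚ X A l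
  edge-support x̂ ĉ p q x̂pq ¬ĉpq = sum≡0⇒∈⇒≡0 (l≥0 x̂) fiber-sum≡0 ĉ∈fiber
    where
    open ≡-Reasoning
    _≟_ = Vec.≡-dec (Digraph._≟_ A)
    y : Edge X
    y = (lookup x̂ p , lookup x̂ q) , x̂pq
    ι : Vec (Fin 2) (2 + n')
    ι = zero ∷ suc zero ∷ replicate n' (suc zero)
    -- Along I = (p, q, q, …, q), x̂ looks like the edge y padded, so (2) and (3) meet.
    I : Vec (Fin (2 + n')) (2 + n')
    I = select (p ∷ q ∷ Vec.[]) ι
    fiber : List (Vec (V A) (2 + n'))
    fiber = filter (λ ĉ′ → select ĉ′ I ≟ select ĉ I) (tuples (Digraph.vertices A) (2 + n'))
    ĉ∈fiber : ĉ ∈ fiber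
    ĉ∈fiber = ∈-filter⁺ _ (tuples-complete (Digraph.complete A) _ ĉ) refl
    over-ĉ? : ∀ b → Dec (select (pair {A} b) ι ≡ select ĉ I)
    over-ĉ? b = select (pair {A} b) ι ≟ select ĉ I
    no-edge-over-ĉ : ∀ b → ¬ (select (pair {A} b) ι ≡ select ĉ I)
    no-edge-over-ĉ ((u , v) , uv) eq with Vec.∷-injectiveˡ eq | Vec.∷-injectiveˡ (Vec.∷-injectiveʳ eq)
    ... | refl | refl = ¬ĉpq uv
    fiber-sum≡0 : sum fiber (l x̂) ≡ 0ℚ
    fiber-sum≡0 = begin
      sum fiber (l x̂)                         ≡⟨ eq2 x̂ (select ĉ I) I ⟩
      l (select x̂ I) (select ĉ I)             ≡⟨ cong (λ z → l z (select ĉ I))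
                                                     (select-select x̂ (p ∷ q ∷ Vec.[]) ι) ⟩
      l (select (pair {X} y) ι) (select ĉ I)  ≡⟨ eq3 y (select ĉ I) ι ⟨
      sum (filter over-ĉ? (edges A)) (m y)    ≡⟨ cong (λ L → sum L (m y))
                                                     (filter-none over-ĉ? (All.universal no-edge-over-ĉ (edges A))) ⟩
      0ℚ                                      ∎

module Transfer {R : Set} {0r 1r : R} {_+_ : R → R → R}
                (+-isCommutativeMonoid : IsCommutativeMonoid _≡_ _+_ 0r)
                {k' : ℕ} {X A : Digraph}
                {l : Vec (V X) (2 * (suc (suc k'))) → Vec (V A) (2 * (suc (suc k'))) → R}
                {m : Edge X → Edge A → R}
                (sol : Solves R 0r 1r _+_ (2 * (suc (suc k'))) X A l m)
                (l-supported : EdgeSupported 0r X A l) where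
  open Solves sol
  open ListSum +-isCommutativeMonoid
  open ≡-Reasoning

  private
    k : ℕ
    k = suc (suc k')
    Eᵏ : List (Vec (Edge A) k)
    Eᵏ = tuples (edges A) k
    Vⁿ : List (Vec (V A) (2 * k))
    Vⁿ = tuples (Digraph.vertices A) (2 * k)
    _≟ₙ_ = Vec.≡-dec {n = 2 * k} (Digraph._≟_ A)
    _≟ₖ_ = Vec.≡-dec {n = k} (_≟E_ A)

  Λ : Vec (Edge X) k → Vec (Edge A) k → R
  Λ x a = l (flatten {X} x) (flatten {A} a)

  M : Edge (δ X) → Edge (δ A) → R
  M y b = Λ (pad {X} y) (pad {A} b)

  l-flatten-supported : ∀ x ĉ → ĉ ∉ map (flatten {A}) Eᵏ → l (flatten {X} x) ĉ ≡ 0r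
  l-flatten-supported x ĉ ĉ∉ with flatten-or-nonEdge {A} {k} ĉ
  ... | inj₁ (c , refl) = ⊥-elim (ĉ∉ (∈-map⁺ (flatten {A}) (tuples-complete (edges-complete A) k c)))
  ... | inj₂ (j , ¬edge) = l-supported (flatten {X} x) ĉ (combine {2} zero j) (combine {2} (suc zero) j)
                                       (edgeAt-flatten {X} x j) ¬edge

  sum-flatten : ∀ {g : Vec (V A) (2 * k) → R} → (∀ ĉ → ĉ ∉ map (flatten {A}) Eᵏ → g ĉ ≡ 0r) →
                sum Eᵏ (g ∘ flatten {A}) ≡ sum Vⁿ g
  sum-flatten = sum-injective-image _≟ₙ_ (flatten-injective {A})
    (tuples-unique (edges-unique A) k) (tuples-unique (Digraph.unique A) (2 * k))
    (tuples-complete (Digraph.complete A) (2 * k))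

  Λ-eq1 : ∀ x → sum Eᵏ (Λ x) ≡ 1r
  Λ-eq1 x = trans (sum-flatten (l-flatten-supported x)) (eq1 (flatten {X} x))

  Λ-eq2 : ∀ x a (i : Vec (Fin k) k) → sum (filter (λ c → select c i ≟ₖ a) Eᵏ) (Λ x) ≡ Λ (select x i) a
  Λ-eq2 x a i = begin
    sum (filter (λ c → select c i ≟ₖ a) Eᵏ) (Λ x)
      ≡⟨ sum-filter (λ c → select c i ≟ₖ a) Eᵏ (Λ x) ⟩
    sum Eᵏ (λ c → if does (select c i ≟ₖ a) then Λ x c else 0r)
      ≡⟨ sum-cong Eᵏ (λ c → cong (λ t → if t then Λ x c else 0r)
                                 (does-⇔ (select-≡⇔ c) (select c i ≟ₖ a) (select (flatten {A} c) I ≟ₙ flatten {A} a)))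
       ⟩
    sum Eᵏ (g ∘ flatten {A})
      ≡⟨ sum-flatten (λ ĉ ĉ∉ → if-zero (select ĉ I ≟ₙ flatten {A} a) λ _ → l-flatten-supported x ĉ ĉ∉) ⟩
    sum Vⁿ g
      ≡⟨ sum-filter (λ ĉ → select ĉ I ≟ₙ flatten {A} a) Vⁿ (l (flatten {X} x)) ⟨
    sum (filter (λ ĉ → select ĉ I ≟ₙ flatten {A} a) Vⁿ) (l (flatten {X} x))
      ≡⟨ eq2 (flatten {X} x) (flatten {A} a) I ⟩
    l (select (flatten {X} x) I) (flatten {A} a)
      ≡⟨ cong (λ z → l z (flatten {A} a)) (select-spread (endpoint {X}) x i) ⟩
    Λ (select x i) a
      ∎
    where
    I : Vec (Fin (2 * k)) (2 * k)
    I = spread combine i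
    g : Vec (V A) (2 * k) → R
    g ĉ = if does (select ĉ I ≟ₙ flatten {A} a) then l (flatten {X} x) ĉ else 0r
    select-≡⇔ : ∀ c → (select c i ≡ a) ⇔ (select (flatten {A} c) I ≡ flatten {A} a)
    select-≡⇔ c = mk⇔
      (λ ci≡a → trans (select-spread (endpoint {A}) c i) (cong (flatten {A}) ci≡a))
      (λ fci≡fa → flatten-injective {A} (trans (sym (select-spread (endpoint {A}) c i)) fci≡fa))

  M-eq3 : ∀ y a (i : Vec (Fin 2) k) →
          sum (filter (λ b → select (pair {δ A} b) i ≟ₖ a) (edges (δ A))) (M y)
            ≡ Λ (select (pair {δ X} y) i) a
  M-eq3 y a i = begin
    sum (filter (λ b → select (pair {δ A} b) i ≟ₖ a) (edges (δ A))) (M y)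
      ≡⟨ sum-filter (λ b → select (pair {δ A} b) i ≟ₖ a) (edges (δ A)) (M y) ⟩
    sum (edges (δ A)) (λ b → if does (select (pair {δ A} b) i ≟ₖ a) then M y b else 0r)
      ≡⟨ sum-cong (edges (δ A)) (λ b → cong (λ v → if does (v ≟ₖ a) then M y b else 0r)
                                             (select-pad {A} b i)) ⟨
    sum (edges (δ A)) (h ∘ pad {A})
      ≡⟨ sum-injective-image _≟ₖ_ (pad-injective {A}) (edges-unique (δ A))
           (tuples-unique (edges-unique A) k) (tuples-complete (edges-complete A) k) h-supported ⟩
    sum Eᵏ h
      ≡⟨ sum-filter (λ c → select c i₂ ≟ₖ a) Eᵏ (Λ (pad {X} y)) ⟨
    sum (filter (λ c → select c i₂ ≟ₖ a) Eᵏ) (Λ (pad {X} y))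
      ≡⟨ Λ-eq2 (pad {X} y) a i₂ ⟩
    Λ (select (pad {X} y) i₂) a
      ≡⟨ cong (λ v → Λ v a) (select-pad {X} y i) ⟩
    Λ (select (pair {δ X} y) i) a
      ∎
    where
    i₂ : Vec (Fin k) k
    i₂ = Vec.map (_↑ˡ k') i
    h : Vec (Edge A) k → R
    h c = if does (select c i₂ ≟ₖ a) then Λ (pad {X} y) c else 0r
    h-supported : ∀ c → c ∉ map (pad {A}) (edges (δ A)) → h c ≡ 0r
    h-supported c c∉ = if-zero (select c i₂ ≟ₖ a) λ _ →
      eq4 (flatten {X} (pad {X} y)) (flatten {A} c) λ pady≺c →
        let (b , padb≡c) = padded {X} {A} y c pady≺c
        in c∉ (subst (_∈ map (pad {A}) (edges (δ A))) padb≡c (∈-map⁺ (pad {A}) (edges-complete (δ A) b)))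

  solves : Solves R 0r 1r _+_ k (δ X) (δ A) Λ M
  solves = record
    { eq1 = Λ-eq1
    ; eq2 = Λ-eq2
    ; eq3 = M-eq3
    ; eq4 = λ x a ¬x≺a → eq4 (flatten {X} x) (flatten {A} a) (¬x≺a ∘ flatten-≺⁻ {X} {A} x a)
    ; eq5 = λ y b ¬y≺b → eq4 (flatten {X} (pad {X} y)) (flatten {A} (pad {A} b))
                             (¬y≺b ∘ pad-≺⁻ {X} {A} y b ∘ flatten-≺⁻ {X} {A} (pad {X} y) (pad {A} b))
    }

proposition2p10 : (k : ℕ) → 2 ≤ k → (X A : Digraph) →
    BA (2 * k) X A → Edge (δ A) → BA k (δ X) (δ A)
proposition2p10 (suc (suc k')) (s≤s (s≤s z≤n)) X A
                (lq , _ , lz , _ , lq≥0 , _ , solq , solz , lq≡0⇒lz≡0 , _) _ =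
  ℚ-solution.Λ , ℚ-solution.M , ℤ-solution.Λ , ℤ-solution.M ,
  (λ _ _ → lq≥0 _ _) , (λ _ _ → lq≥0 _ _) ,
  ℚ-solution.solves , ℤ-solution.solves ,
  (λ _ _ → lq≡0⇒lz≡0 _ _) , (λ _ _ → lq≡0⇒lz≡0 _ _)
  where
  lq-supported : EdgeSupported 0ℚ X A lq
  lq-supported = edge-support solq lq≥0
  lz-supported : EdgeSupported 0ℤ X A lz
  lz-supported x̂ ĉ p q x̂pq ¬ĉpq = lq≡0⇒lz≡0 x̂ ĉ (lq-supported x̂ ĉ p q x̂pq ¬ĉpq)
  module ℚ-solution = Transfer ℚP.+-0-isCommutativeMonoid solq lq-supported
  module ℤ-solution = Transfer ℤP.+-0-isCommutativeMonoid solz lz-supported
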